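{- Let $G=(V,E)$ be a nonempty finite graph in which every vertex carries a loop, and let $H$ be a graph on the same vertex set obtained from $G$ by deleting $l$ non-loop edges and adding $m$ non-loop edges (loops kept). Then $$-4l-2m\le \gamma(G)-\gamma(H)\le 2l+4m.$$
   Context: All graphs are finite with vertex set $V$, $|V|=n$, and every vertex has a loop. For $v\in V$, the neighborhood $N_v=\{w\in V:(v,w)\in E\}$ contains $v$ itself. An opinion function is a map $f:V\to\{ -1,1\}$, extended to subsets by $f(W)=\sum_{w\in W}f(w)$. $V^+=\{v\in V: f(N_v)>0\}$. The opinion function $f$ is strictly majoritarian on the graph if $|V^+|>|V|/2$. The strict domination number is $\gamma(G)=\min\{f(V): f \text{ strictly majoritarian on } G\}$. -}

module Defs where

open import Data.Nat as ℕ using (ℕ; suc)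
open import Data.Integer as ℤ using (ℤ; 0ℤ; 1ℤ; -1ℤ)
open import Data.Bool using (Bool; true; false; if_then_else_; _∧_; not; T)
open import Data.Fin as Fin using (Fin; toℕ)
open import Data.List using (List; foldr; map; filter; length; allFin; cartesianProduct)
open import Data.Product using (_×_; _,_; ∃; Σ)
open import Relation.Binary.PropositionalEquality using (_≡_)
open import Relation.Nullary.Decidable using (_×-dec_)
open import Data.Bool.Properties using (T?)

record Graph (n : ℕ) : Set where
  field
    adj  : Fin n → Fin n → Bool
    sym  : ∀ v w → adj v w ≡ adj w v
    loop : ∀ v → adj v v ≡ true
open Graph public

-- Opinion function f : V → {-1, 1}; true ↦ 1, false ↦ -1.
Opinion : ℕ → Set
Opinion n = Fin n → Bool

val : Bool → ℤ
val true  = 1ℤ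
val false = -1ℤ

sumℤ : List ℤ → ℤ
sumℤ = foldr ℤ._+_ 0ℤ

total : ∀ {n} → Opinion n → ℤ
total {n} f = sumℤ (map (λ w → val (f w)) (allFin n))

nbhdSum : ∀ {n} → Graph n → Opinion n → Fin n → ℤ
nbhdSum {n} G f v = sumℤ (map (λ w → if adj G v w then val (f w) else 0ℤ) (allFin n))

Vplus : ∀ {n} → Graph n → Opinion n → List (Fin n)
Vplus {n} G f = filter (λ v → 0ℤ ℤ.<? nbhdSum G f v) (allFin n)

-- strictly majoritarian: |V⁺| > |V|/2, i.e. n < 2 |V⁺|
StrictlyMajoritarian : ∀ {n} → Graph n → Opinion n → Set
StrictlyMajoritarian {n} G f = n ℕ.< 2 ℕ.* length (Vplus G f)

IsStrictDomNumber : ∀ {n} → Graph n → ℤ → Set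
IsStrictDomNumber {n} G g =
  Σ (Opinion n) (λ f → StrictlyMajoritarian G f × total f ≡ g)
  × (∀ (f : Opinion n) → StrictlyMajoritarian G f → g ℤ.≤ total f)

deletedEdges : ∀ {n} → Graph n → Graph n → ℕ
deletedEdges {n} G H =
  length (filter (λ p → (Data.Product.proj₁ p Fin.<? Data.Product.proj₂ p)
                          ×-dec T? (adj G (Data.Product.proj₁ p) (Data.Product.proj₂ p)
                                    ∧ not (adj H (Data.Product.proj₁ p) (Data.Product.proj₂ p))))
                 (cartesianProduct (allFin n) (allFin n)))

-- Turn G into H one edge at a time, carrying along a strictly majoritarian opinion f and
-- checking that no vertex of V⁺ is lost; as f only ever moves up, only the two endpoints of
-- the edited edge need care.  Adding vw shifts f(N_v) by f(w) ≥ -1: switching a dissenting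
-- endpoint to +1 (cost 2) repairs both ends.  Deleting vw lowers f(N_v) by at most 1, so it
-- stays ≥ 0; switching one dissenter of the new N_v to +1 makes it positive, and if there is
-- none, f(N_v) > 0 already.  Doing this at both ends costs at most 4.  Hence
-- γ(H) ≤ γ(G) + 4l + 2m, and exchanging G and H gives the other inequality.
module Submission where

open import Defs
open import Data.Bool as Bool using (Bool; true; false; if_then_else_; _∧_; not; T; b≤b; f≤t)
import Data.Bool.Properties as Boolₚ
open import Data.Fin as Fin using (Fin; zero; suc)
open import Data.Fin.Properties using (_≟_; any?; suc-injective; <⇒≢; <-cmp)
open import Data.Integer as ℤ using (ℤ; _+_; _-_; _*_; -_; _≤_; _<_; +_; 0ℤ; 1ℤ; -1ℤ; +≤+; +<+; -≤+)
import Data.Integer.Properties as ℤₚ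
open import Data.Integer.Tactic.RingSolver using (solve-∀)
open import Data.List using (List; []; _∷_; map; filter; length; allFin; tabulate; foldr; cartesianProduct)
open import Data.List.Properties using (map-tabulate)
open import Data.List.Membership.Propositional using (_∈_)
open import Data.List.Membership.Propositional.Properties using (∈-cartesianProduct⁺; ∈-allFin)
open import Data.List.Relation.Unary.Any using (here; there)
open import Data.List.Relation.Binary.Sublist.Propositional using (⊆-refl)
open import Data.List.Relation.Binary.Sublist.Propositional.Properties using (filter⁺; length-mono-≤)
open import Data.Nat as ℕ using (ℕ; zero; suc; z≤n; s≤s)
open import Data.Nat.ListAction using (sum)
import Data.Nat.Properties as ℕₚ
import Data.Nat.Tactic.RingSolver as ℕ-Solver
open import Data.Product using (_×_; _,_; ∃-syntax; proj₁)
open import Data.Sum using (_⊎_; inj₁; inj₂; [_,_])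
import Data.Sum as Sum
open import Data.Vec.Functional using (updateAt)
open import Data.Vec.Functional.Properties using (updateAt-updates; updateAt-minimal)
open import Function using (_∘_; id; const)
open import Function.Bundles using (mk⇔)
open import Relation.Binary.Definitions using (tri<; tri≈; tri>)
import Relation.Binary.PropositionalEquality as ≡
open ≡ using (_≡_; _≢_; refl; cong; cong₂; trans; subst)
open import Relation.Nullary using (¬_; Dec; yes; no; does; contradiction)
open import Relation.Nullary.Decidable using (T?; _×-dec_; _⊎-dec_; dec-true; dec-false; does-⇔)

private
  variable
    n : ℕ

∑ : ∀ n → (Fin n → ℤ) → ℤ
∑ zero    g = 0ℤ
∑ (suc n) g = g zero + ∑ n (g ∘ suc)

sumℤ-tabulate : (g : Fin n → ℤ) → sumℤ (tabulate g) ≡ ∑ n g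
sumℤ-tabulate {zero}  g = refl
sumℤ-tabulate {suc n} g = cong (λ s → g zero + s) (sumℤ-tabulate (g ∘ suc))

sumℤ-map-allFin : (g : Fin n → ℤ) → sumℤ (map g (allFin n)) ≡ ∑ n g
sumℤ-map-allFin g = trans (cong sumℤ (map-tabulate id g)) (sumℤ-tabulate g)

∑-cong : {g h : Fin n → ℤ} → (∀ x → g x ≡ h x) → ∑ n g ≡ ∑ n h
∑-cong {zero}  eq = refl
∑-cong {suc n} eq = cong₂ _+_ (eq zero) (∑-cong (eq ∘ suc))

∑-mono-≤ : {g h : Fin n → ℤ} → (∀ x → g x ≤ h x) → ∑ n g ≤ ∑ n h
∑-mono-≤ {zero}  le = ℤₚ.≤-refl
∑-mono-≤ {suc n} le = ℤₚ.+-mono-≤ (le zero) (∑-mono-≤ (le ∘ suc))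

∑-nonneg : {g : Fin n → ℤ} → (∀ x → 0ℤ ≤ g x) → 0ℤ ≤ ∑ n g
∑-nonneg {zero}  nonneg = ℤₚ.≤-refl
∑-nonneg {suc n} nonneg = ℤₚ.+-mono-≤ (nonneg zero) (∑-nonneg (nonneg ∘ suc))

∑-pos : {g : Fin n → ℤ} (u : Fin n) → (∀ x → 0ℤ ≤ g x) → 0ℤ < g u → 0ℤ < ∑ n g
∑-pos zero    nonneg pos = ℤₚ.+-mono-<-≤ pos (∑-nonneg (nonneg ∘ suc))
∑-pos (suc u) nonneg pos = ℤₚ.+-mono-≤-< (nonneg zero) (∑-pos u (nonneg ∘ suc) pos)

∑-update : {g h : Fin n → ℤ} (t : Fin n) → (∀ x → x ≢ t → g x ≡ h x) → ∑ n h ≡ ∑ n g + (h t - g t)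
∑-update {suc n} {g} {h} zero eq = begin
  h zero + ∑ n (h ∘ suc)                     ≡⟨ cong (λ s → h zero + s) (∑-cong (λ x → eq (suc x) λ ())) ⟨
  h zero + ∑ n (g ∘ suc)                     ≡⟨ shift (g zero) (h zero) (∑ n (g ∘ suc)) ⟩
  g zero + ∑ n (g ∘ suc) + (h zero - g zero) ∎
  where
  open ≡.≡-Reasoning
  shift : ∀ a b s → b + s ≡ a + s + (b - a)
  shift = solve-∀
∑-update {suc n} {g} {h} (suc t) eq = begin
  h zero + ∑ n (h ∘ suc)
    ≡⟨ cong₂ _+_ (≡.sym (eq zero λ ())) (∑-update t (λ x x≢t → eq (suc x) (x≢t ∘ suc-injective))) ⟩
  g zero + (∑ n (g ∘ suc) + (h (suc t) - g (suc t)))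
    ≡⟨ ℤₚ.+-assoc (g zero) _ _ ⟨
  g zero + ∑ n (g ∘ suc) + (h (suc t) - g (suc t))
    ∎
  where open ≡.≡-Reasoning

-1≤val : ∀ b → -1ℤ ≤ val b
-1≤val true  = -≤+
-1≤val false = ℤₚ.≤-refl

val≤1 : ∀ b → val b ≤ 1ℤ
val≤1 true  = ℤₚ.≤-refl
val≤1 false = -≤+

val-mono : {b b′ : Bool} → b Bool.≤ b′ → val b ≤ val b′
val-mono b≤b = ℤₚ.≤-refl
val-mono f≤t = -≤+

infix 4 _≤ₒ_
_≤ₒ_ : Opinion n → Opinion n → Set
f ≤ₒ g = ∀ x → f x Bool.≤ g x

≤ₒ-trans : {f g h : Opinion n} → f ≤ₒ g → g ≤ₒ h → f ≤ₒ h
≤ₒ-trans f≤g g≤h x = Boolₚ.≤-trans (f≤g x) (g≤h x)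

raise : Opinion n → Fin n → Opinion n
raise f t = updateAt f t (const true)

raise-at : (f : Opinion n) (t : Fin n) → raise f t t ≡ true
raise-at f t = updateAt-updates t f

raise-other : (f : Opinion n) {t x : Fin n} → x ≢ t → raise f t x ≡ f x
raise-other f {t} {x} = updateAt-minimal x t f

≤-raise : (f : Opinion n) (t : Fin n) → f ≤ₒ raise f t
≤-raise f t x with x ≟ t
... | yes refl = subst (f x Bool.≤_) (≡.sym (raise-at f x)) (Boolₚ.≤-maximum (f x))
... | no x≢t   = Boolₚ.≤-reflexive (≡.sym (raise-other f x≢t))

valOn : (Fin n → Bool) → Opinion n → Fin n → ℤ
valOn N f x = if N x then val (f x) else 0ℤ

sumOn : (Fin n → Bool) → Opinion n → ℤ
sumOn {n} N f = ∑ n (valOn N f)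

nbhdSum≡sumOn : (G : Graph n) (f : Opinion n) (u : Fin n) → nbhdSum G f u ≡ sumOn (adj G u) f
nbhdSum≡sumOn G f u = sumℤ-map-allFin (valOn (adj G u) f)

total≡sumOn : (f : Opinion n) → total f ≡ sumOn (const true) f
total≡sumOn f = sumℤ-map-allFin (val ∘ f)

sumOn-cong : {N N′ : Fin n → Bool} (f : Opinion n) → (∀ x → N x ≡ N′ x) → sumOn N f ≡ sumOn N′ f
sumOn-cong f eq = ∑-cong (λ x → cong (λ b → if b then val (f x) else 0ℤ) (eq x))

sumOn-mono : (N : Fin n → Bool) {f f′ : Opinion n} → f ≤ₒ f′ → sumOn N f ≤ sumOn N f′
sumOn-mono N {f} {f′} f≤f′ = ∑-mono-≤ valOn-mono
  where
  valOn-mono : ∀ x → valOn N f x ≤ valOn N f′ x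
  valOn-mono x with N x
  ... | true  = val-mono (f≤f′ x)
  ... | false = ℤₚ.≤-refl

sumOn-pos : {N : Fin n → Bool} {f : Opinion n} (u : Fin n) → N u ≡ true
          → (∀ x → N x ≡ true → f x ≡ true) → 0ℤ < sumOn N f
sumOn-pos {N = N} {f} u Nu agree = ∑-pos u valOn-nonneg valOn-u
  where
  valOn-nonneg : ∀ x → 0ℤ ≤ valOn N f x
  valOn-nonneg x with N x in Nx
  ... | true  = subst (λ b → 0ℤ ≤ val b) (≡.sym (agree x Nx)) (+≤+ z≤n)
  ... | false = ℤₚ.≤-refl
  valOn-u : 0ℤ < valOn N f u
  valOn-u rewrite Nu | agree u Nu = +<+ (s≤s z≤n)

sumOn-insert : {N N′ : Fin n → Bool} (f : Opinion n) (o : Fin n) → (∀ x → x ≢ o → N x ≡ N′ x)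
             → N o ≡ false → N′ o ≡ true → sumOn N′ f ≡ sumOn N f + val (f o)
sumOn-insert {N = N} {N′} f o agree No N′o = begin
  sumOn N′ f
    ≡⟨ ∑-update o (λ x x≢o → cong (λ b → if b then val (f x) else 0ℤ) (agree x x≢o)) ⟩
  sumOn N f + (valOn N′ f o - valOn N f o)
    ≡⟨ cong₂ (λ b c → sumOn N f + ((if b then val (f o) else 0ℤ) - (if c then val (f o) else 0ℤ))) N′o No ⟩
  sumOn N f + (val (f o) + 0ℤ)
    ≡⟨ cong (λ s → sumOn N f + s) (ℤₚ.+-identityʳ (val (f o))) ⟩
  sumOn N f + val (f o)
    ∎
  where open ≡.≡-Reasoning

sumOn-raise : (N : Fin n → Bool) (f : Opinion n) {t : Fin n} → N t ≡ true → f t ≡ false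
            → sumOn N (raise f t) ≡ sumOn N f + + 2
sumOn-raise N f {t} Nt ft = begin
  sumOn N (raise f t)
    ≡⟨ ∑-update t (λ x x≢t → cong (λ b → if N x then val b else 0ℤ) (≡.sym (raise-other f x≢t))) ⟩
  sumOn N f + (valOn N (raise f t) t - valOn N f t)
    ≡⟨ cong (λ b → sumOn N f + ((if b then val (raise f t t) else 0ℤ) - (if b then val (f t) else 0ℤ))) Nt ⟩
  sumOn N f + (val (raise f t t) - val (f t))
    ≡⟨ cong₂ (λ b c → sumOn N f + (val b - val c)) (raise-at f t) ft ⟩
  sumOn N f + + 2
    ∎
  where open ≡.≡-Reasoning

total-raise : (f : Opinion n) (t : Fin n) → total (raise f t) ≤ total f + + 2
total-raise f t = begin
  total (raise f t)
    ≡⟨ total≡sumOn (raise f t) ⟩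
  sumOn (const true) (raise f t)
    ≡⟨ ∑-update t (λ x x≢t → cong val (≡.sym (raise-other f x≢t))) ⟩
  sumOn (const true) f + (val (raise f t t) - val (f t))
    ≤⟨ ℤₚ.+-monoʳ-≤ (sumOn (const true) f) (switch≤2 (f t)) ⟩
  sumOn (const true) f + + 2
    ≡⟨ cong (_+ + 2) (total≡sumOn f) ⟨
  total f + + 2
    ∎
  where
  open ℤₚ.≤-Reasoning
  switch≤2 : ∀ b → val (raise f t t) - val b ≤ + 2
  switch≤2 b rewrite raise-at f t = ℤₚ.+-monoʳ-≤ 1ℤ (ℤₚ.neg-mono-≤ (-1≤val b))

sumOn-insert-pos : {N N′ : Fin n → Bool} {f f′ : Opinion n} (o : Fin n) → (∀ x → x ≢ o → N x ≡ N′ x)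
  → N o ≡ false → N′ o ≡ true → f ≤ₒ f′ → f′ o ≡ true ⊎ sumOn N f + + 2 ≤ sumOn N f′
  → 0ℤ < sumOn N f → 0ℤ < sumOn N′ f′
sumOn-insert-pos {N = N} {N′} {f} {f′} o agree No N′o f≤f′ gain pos = begin-strict
  0ℤ                      <⟨ pos ⟩
  sumOn N f               ≤⟨ ℤₚ.i≤i+j (sumOn N f) 1ℤ ⟩
  sumOn N f + 1ℤ          ≤⟨ step gain ⟩
  sumOn N f′ + val (f′ o) ≡⟨ sumOn-insert f′ o agree No N′o ⟨
  sumOn N′ f′             ∎
  where
  open ℤₚ.≤-Reasoning
  step : f′ o ≡ true ⊎ sumOn N f + + 2 ≤ sumOn N f′ → sumOn N f + 1ℤ ≤ sumOn N f′ + val (f′ o)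
  step (inj₁ f′o) rewrite f′o = ℤₚ.+-monoˡ-≤ 1ℤ (sumOn-mono N f≤f′)
  step (inj₂ le) = ℤₚ.≤-trans (ℤₚ.≤-reflexive (shift (sumOn N f))) (ℤₚ.+-mono-≤ le (-1≤val (f′ o)))
    where
    shift : ∀ s → s + 1ℤ ≡ s + + 2 + -1ℤ
    shift = solve-∀

sumOn-delete-nonneg : {N N′ : Fin n → Bool} (f : Opinion n) (o : Fin n) → (∀ x → x ≢ o → N x ≡ N′ x)
  → N o ≡ true → N′ o ≡ false → 0ℤ < sumOn N f → 0ℤ ≤ sumOn N′ f
sumOn-delete-nonneg {N = N} {N′} f o agree No N′o pos = begin
  0ℤ                       ≤⟨ ℤₚ.i<j⇒i≤pred[j] (ℤₚ.<-≤-trans pos sumOn-N≤) ⟩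
  ℤ.pred (sumOn N′ f + 1ℤ) ≡⟨ pred-suc (sumOn N′ f) ⟩
  sumOn N′ f               ∎
  where
  open ℤₚ.≤-Reasoning
  sumOn-N≤ : sumOn N f ≤ sumOn N′ f + 1ℤ
  sumOn-N≤ = ℤₚ.≤-trans (ℤₚ.≤-reflexive (sumOn-insert f o (λ x x≢o → ≡.sym (agree x x≢o)) N′o No))
                        (ℤₚ.+-monoʳ-≤ (sumOn N′ f) (val≤1 (f o)))
  pred-suc : ∀ s → -1ℤ + (s + 1ℤ) ≡ s
  pred-suc = solve-∀

Dissents : (Fin n → Bool) → Opinion n → Fin n → Set
Dissents N f t = N t ≡ true × f t ≡ false

dissenter? : (N : Fin n → Bool) (f : Opinion n) → Dec (∃[ t ] Dissents N f t)
dissenter? N f = any? (λ t → (N t Boolₚ.≟ true) ×-dec (f t Boolₚ.≟ false))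

rescue : (Fin n → Bool) → Opinion n → Opinion n
rescue N f with dissenter? N f
... | yes (t , _) = raise f t
... | no _        = f

≤-rescue : (N : Fin n → Bool) (f : Opinion n) → f ≤ₒ rescue N f
≤-rescue N f with dissenter? N f
... | yes (t , _) = ≤-raise f t
... | no _        = λ x → Boolₚ.≤-refl

total-rescue : (N : Fin n → Bool) (f : Opinion n) → total (rescue N f) ≤ total f + + 2
total-rescue N f with dissenter? N f
... | yes (t , _) = total-raise f t
... | no _        = ℤₚ.i≤i+j (total f) (+ 2)

rescue-pos : (N : Fin n → Bool) (f : Opinion n) (u : Fin n) → N u ≡ true
           → 0ℤ ≤ sumOn N f → 0ℤ < sumOn N (rescue N f)
rescue-pos N f u Nu nonneg with dissenter? N f
... | yes (t , Nt , ft) = begin-strict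
  0ℤ                  <⟨ +<+ (s≤s z≤n) ⟩
  + 2                 ≤⟨ ℤₚ.+-monoˡ-≤ (+ 2) nonneg ⟩
  sumOn N f + + 2     ≡⟨ sumOn-raise N f Nt ft ⟨
  sumOn N (raise f t) ∎
  where open ℤₚ.≤-Reasoning
... | no none = sumOn-pos u Nu consenting
  where
  consenting : ∀ x → N x ≡ true → f x ≡ true
  consenting x Nx with f x in fx
  ... | true  = refl
  ... | false = contradiction (x , Nx , fx) none

majoritarian-transfer : (G G′ : Graph n) {f f′ : Opinion n}
  → (∀ u → 0ℤ < sumOn (adj G u) f → 0ℤ < sumOn (adj G′ u) f′)
  → StrictlyMajoritarian G f → StrictlyMajoritarian G′ f′
majoritarian-transfer {n} G G′ {f} {f′} pos⇒pos sm = ℕₚ.<-≤-trans sm (ℕₚ.*-monoʳ-≤ 2 Vplus-grows)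
  where
  stays : ∀ {u u′} → u ≡ u′ → 0ℤ < nbhdSum G f u → 0ℤ < nbhdSum G′ f′ u′
  stays {u} refl pos = subst (0ℤ <_) (≡.sym (nbhdSum≡sumOn G′ f′ u))
                             (pos⇒pos u (subst (0ℤ <_) (nbhdSum≡sumOn G f u) pos))
  Vplus-grows : length (Vplus G f) ℕ.≤ length (Vplus G′ f′)
  Vplus-grows = length-mono-≤ (filter⁺ (λ u → 0ℤ ℤ.<? nbhdSum G f u) (λ u → 0ℤ ℤ.<? nbhdSum G′ f′ u)
                                       stays (⊆-refl {x = allFin n}))

majoritarian-cong : (G G′ : Graph n) → (∀ x y → adj G x y ≡ adj G′ x y)
  → (f : Opinion n) → StrictlyMajoritarian G f → StrictlyMajoritarian G′ f
majoritarian-cong G G′ G≡G′ f = majoritarian-transfer G G′ (λ u → subst (0ℤ <_) (sumOn-cong f (G≡G′ u)))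

SameEnds : (v w x y : Fin n) → Set
SameEnds v w x y = (x ≡ v × y ≡ w) ⊎ (x ≡ w × y ≡ v)

sameEnds? : (v w x y : Fin n) → Dec (SameEnds v w x y)
sameEnds? v w x y = (x ≟ v ×-dec y ≟ w) ⊎-dec (x ≟ w ×-dec y ≟ v)

sameEnds-swap : {v w x y : Fin n} → SameEnds v w x y → SameEnds v w y x
sameEnds-swap (inj₁ (x≡v , y≡w)) = inj₂ (y≡w , x≡v)
sameEnds-swap (inj₂ (x≡w , y≡v)) = inj₁ (y≡v , x≡w)

sameEnds-unique : {v w u o x : Fin n} → v ≢ w → SameEnds v w u o → SameEnds v w u x → x ≡ o
sameEnds-unique v≢w (inj₁ (refl , refl)) (inj₁ (_ , refl)) = refl
sameEnds-unique v≢w (inj₁ (refl , refl)) (inj₂ (refl , _)) = contradiction refl v≢w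
sameEnds-unique v≢w (inj₂ (refl , refl)) (inj₁ (refl , _)) = contradiction refl v≢w
sameEnds-unique v≢w (inj₂ (refl , refl)) (inj₂ (_ , refl)) = refl

adj-sameEnds : (G : Graph n) {v w x y : Fin n} → SameEnds v w x y → adj G v w ≡ adj G x y
adj-sameEnds G (inj₁ (refl , refl)) = refl
adj-sameEnds G (inj₂ (refl , refl)) = Graph.sym G _ _

setEdge : (C : Graph n) {v w : Fin n} → v ≢ w → Bool → Graph n
setEdge C {v} {w} v≢w b = record
  { adj  = λ x y → if does (sameEnds? v w x y) then b else adj C x y
  ; sym  = λ x y → cong₂ (λ c d → if c then b else d)
                         (does-⇔ (mk⇔ sameEnds-swap sameEnds-swap) (sameEnds? v w x y) (sameEnds? v w y x))
                         (Graph.sym C x y)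
  ; loop = λ x → trans (cong (λ c → if c then b else adj C x x) (dec-false (sameEnds? v w x x) (not-loop x)))
                       (loop C x)
  }
  where
  not-loop : ∀ x → ¬ SameEnds v w x x
  not-loop x (inj₁ (x≡v , x≡w)) = v≢w (trans (≡.sym x≡v) x≡w)
  not-loop x (inj₂ (x≡w , x≡v)) = v≢w (trans (≡.sym x≡v) x≡w)

module _ (C : Graph n) {v w : Fin n} (v≢w : v ≢ w) (b : Bool) where

  setEdge-sameEnds : {x y : Fin n} → SameEnds v w x y → adj (setEdge C v≢w b) x y ≡ b
  setEdge-sameEnds {x} {y} e = cong (λ c → if c then b else adj C x y) (dec-true (sameEnds? v w x y) e)

  setEdge-other : {x y : Fin n} → ¬ SameEnds v w x y → adj (setEdge C v≢w b) x y ≡ adj C x y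
  setEdge-other {x} {y} ¬e = cong (λ c → if c then b else adj C x y) (dec-false (sameEnds? v w x y) ¬e)

  setEdge-unchanged : adj C v w ≡ b → ∀ x y → adj C x y ≡ adj (setEdge C v≢w b) x y
  setEdge-unchanged Cvw≡b x y with sameEnds? v w x y
  ... | yes e = trans (≡.sym (adj-sameEnds C e)) (trans Cvw≡b (≡.sym (setEdge-sameEnds e)))
  ... | no ¬e = ≡.sym (setEdge-other ¬e)

  setEdge-endRow : {u o : Fin n} → SameEnds v w u o → ∀ x → x ≢ o → adj C u x ≡ adj (setEdge C v≢w b) u x
  setEdge-endRow e x x≢o = ≡.sym (setEdge-other (x≢o ∘ sameEnds-unique v≢w e))

  setEdge-transfer : {f f′ : Opinion n} → f ≤ₒ f′
    → (∀ {u o} → SameEnds v w u o → 0ℤ < sumOn (adj C u) f → 0ℤ < sumOn (adj (setEdge C v≢w b) u) f′)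
    → StrictlyMajoritarian C f → StrictlyMajoritarian (setEdge C v≢w b) f′
  setEdge-transfer {f} {f′} f≤f′ endpoint = majoritarian-transfer C (setEdge C v≢w b) pos⇒pos
    where
    pos⇒pos : ∀ u → 0ℤ < sumOn (adj C u) f → 0ℤ < sumOn (adj (setEdge C v≢w b) u) f′
    pos⇒pos u = by-cases (u ≟ v) (u ≟ w)
      where
      by-cases : Dec (u ≡ v) → Dec (u ≡ w)
               → 0ℤ < sumOn (adj C u) f → 0ℤ < sumOn (adj (setEdge C v≢w b) u) f′
      by-cases (yes refl) _          = endpoint (inj₁ (refl , refl))
      by-cases (no _)     (yes refl) = endpoint (inj₂ (refl , refl))
      by-cases (no u≢v)   (no u≢w)   pos = ℤₚ.<-≤-trans pos (ℤₚ.≤-trans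
        (ℤₚ.≤-reflexive (sumOn-cong f (λ x → ≡.sym (setEdge-other [ u≢v ∘ proj₁ , u≢w ∘ proj₁ ]))))
        (sumOn-mono _ f≤f′))

module _ (C : Graph n) {v w : Fin n} (v≢w : v ≢ w) where

  addEdge-switching : adj C v w ≡ false → (f : Opinion n) → StrictlyMajoritarian C f → (t : Fin n)
    → (∀ {u o} → SameEnds v w u o
               → raise f t o ≡ true ⊎ sumOn (adj C u) f + + 2 ≤ sumOn (adj C u) (raise f t))
    → ∃[ f′ ] StrictlyMajoritarian (setEdge C v≢w true) f′ × total f′ ≤ total f + + 2
  addEdge-switching vw∉C f sm t good =
    raise f t , setEdge-transfer C v≢w true (≤-raise f t) endpoint sm , total-raise f t
    where
    endpoint : ∀ {u o} → SameEnds v w u o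
             → 0ℤ < sumOn (adj C u) f → 0ℤ < sumOn (adj (setEdge C v≢w true) u) (raise f t)
    endpoint {o = o} e = sumOn-insert-pos o (setEdge-endRow C v≢w true e) (trans (≡.sym (adj-sameEnds C e)) vw∉C)
                                          (setEdge-sameEnds C v≢w true e) (≤-raise f t) (good e)

  addEdge : adj C v w ≡ false → (f : Opinion n) → StrictlyMajoritarian C f
    → ∃[ f′ ] StrictlyMajoritarian (setEdge C v≢w true) f′ × total f′ ≤ total f + + 2
  addEdge vw∉C f sm with f v in fv
  ... | true  = addEdge-switching vw∉C f sm w λ
    { (inj₁ (refl , refl)) → inj₁ (raise-at f w)
    ; (inj₂ (refl , refl)) → inj₁ (trans (raise-other f v≢w) fv) }
  ... | false = addEdge-switching vw∉C f sm v λ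
    { (inj₁ (refl , refl)) → inj₂ (ℤₚ.≤-reflexive (≡.sym (sumOn-raise (adj C v) f (loop C v) fv)))
    ; (inj₂ (refl , refl)) → inj₁ (raise-at f v) }

  deleteEdge : adj C v w ≡ true → (f : Opinion n) → StrictlyMajoritarian C f
    → ∃[ f′ ] StrictlyMajoritarian (setEdge C v≢w false) f′ × total f′ ≤ total f + + 4
  deleteEdge vw∈C f sm =
    f₂ , setEdge-transfer C v≢w false (≤ₒ-trans (≤-rescue _ f) (≤-rescue _ f₁)) endpoint sm , cost
    where
    C′ = setEdge C v≢w false
    f₁ = rescue (adj C′ v) f
    f₂ = rescue (adj C′ w) f₁
    drops-to-nonneg : ∀ {u o} → SameEnds v w u o → 0ℤ < sumOn (adj C u) f → 0ℤ ≤ sumOn (adj C′ u) f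
    drops-to-nonneg {o = o} e = sumOn-delete-nonneg f o (setEdge-endRow C v≢w false e)
                                  (trans (≡.sym (adj-sameEnds C e)) vw∈C) (setEdge-sameEnds C v≢w false e)
    endpoint : ∀ {u o} → SameEnds v w u o → 0ℤ < sumOn (adj C u) f → 0ℤ < sumOn (adj C′ u) f₂
    endpoint e@(inj₁ (refl , refl)) pos =
      ℤₚ.<-≤-trans (rescue-pos _ f v (loop C′ v) (drops-to-nonneg e pos)) (sumOn-mono _ (≤-rescue _ f₁))
    endpoint e@(inj₂ (refl , refl)) pos =
      rescue-pos _ f₁ w (loop C′ w) (ℤₚ.≤-trans (drops-to-nonneg e pos) (sumOn-mono _ (≤-rescue _ f)))
    cost : total f₂ ≤ total f + + 4
    cost = begin
      total f₂            ≤⟨ total-rescue _ f₁ ⟩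
      total f₁ + + 2      ≤⟨ ℤₚ.+-monoˡ-≤ (+ 2) (total-rescue _ f) ⟩
      total f + + 2 + + 2 ≡⟨ ℤₚ.+-assoc (total f) (+ 2) (+ 2) ⟩
      total f + + 4       ∎
      where open ℤₚ.≤-Reasoning

editCost : Bool → Bool → ℕ
editCost true  false = 4
editCost false true  = 2
editCost _     _     = 0

editCost-split : ∀ a b → editCost a b ≡ (if a ∧ not b then 4 else 0) ℕ.+ (if b ∧ not a then 2 else 0)
editCost-split true  true  = refl
editCost-split true  false = refl
editCost-split false true  = refl
editCost-split false false = refl

editCost-between : ∀ {a b c} → c ≡ a ⊎ c ≡ b → editCost c b ℕ.≤ editCost a b
editCost-between             (inj₁ refl) = ℕₚ.≤-refl
editCost-between {b = true}  (inj₂ refl) = z≤n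
editCost-between {b = false} (inj₂ refl) = z≤n

setEdge-cost : (C : Graph n) {v w : Fin n} (v≢w : v ≢ w) (b : Bool) (f : Opinion n)
  → StrictlyMajoritarian C f
  → ∃[ f′ ] StrictlyMajoritarian (setEdge C v≢w b) f′ × total f′ ≤ total f + + editCost (adj C v w) b
setEdge-cost C {v} {w} v≢w true f sm with adj C v w in vw
... | true  = f , majoritarian-cong C (setEdge C v≢w true) (setEdge-unchanged C v≢w true vw) f sm
                , ℤₚ.i≤i+j (total f) (+ 0)
... | false = addEdge C v≢w vw f sm
setEdge-cost C {v} {w} v≢w false f sm with adj C v w in vw
... | true  = deleteEdge C v≢w vw f sm
... | false = f , majoritarian-cong C (setEdge C v≢w false) (setEdge-unchanged C v≢w false vw) f sm
                , ℤₚ.i≤i+j (total f) (+ 0)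

Deleted : Graph n → Graph n → Fin n × Fin n → Set
Deleted G H (v , w) = v Fin.< w × T (adj G v w ∧ not (adj H v w))

deleted? : (G H : Graph n) (p : Fin n × Fin n) → Dec (Deleted G H p)
deleted? G H (v , w) = (v Fin.<? w) ×-dec T? (adj G v w ∧ not (adj H v w))

allPairs : ∀ n → List (Fin n × Fin n)
allPairs n = cartesianProduct (allFin n) (allFin n)

pairCost : Graph n → Graph n → Fin n × Fin n → ℕ
pairCost A B p = (if does (deleted? A B p) then 4 else 0) ℕ.+ (if does (deleted? B A p) then 2 else 0)

pairCost-< : (A B : Graph n) {v w : Fin n} → v Fin.< w → pairCost A B (v , w) ≡ editCost (adj A v w) (adj B v w)
pairCost-< A B {v} {w} v<w = trans
  (cong (λ d → (if d ∧ (adj A v w ∧ not (adj B v w)) then 4 else 0)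
               ℕ.+ (if d ∧ (adj B v w ∧ not (adj A v w)) then 2 else 0))
        (dec-true (v Fin.<? w) v<w))
  (≡.sym (editCost-split (adj A v w) (adj B v w)))

sum-map-indicators : {A : Set} {P Q : A → Set} (P? : ∀ x → Dec (P x)) (Q? : ∀ x → Dec (Q x))
  (a b : ℕ) (L : List A)
  → sum (map (λ x → (if does (P? x) then a else 0) ℕ.+ (if does (Q? x) then b else 0)) L)
    ≡ a ℕ.* length (filter P? L) ℕ.+ b ℕ.* length (filter Q? L)
sum-map-indicators P? Q? a b [] = ≡.sym (cong₂ ℕ._+_ (ℕₚ.*-zeroʳ a) (ℕₚ.*-zeroʳ b))
sum-map-indicators P? Q? a b (x ∷ L) with does (P? x) | does (Q? x) | sum-map-indicators P? Q? a b L
... | true  | true  | ih = trans (cong ((a ℕ.+ b) ℕ.+_) ih) (both a b _ _)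
  where
  both : ∀ a b k l → (a ℕ.+ b) ℕ.+ (a ℕ.* k ℕ.+ b ℕ.* l) ≡ a ℕ.* suc k ℕ.+ b ℕ.* suc l
  both = ℕ-Solver.solve-∀
... | true  | false | ih = trans (cong ((a ℕ.+ 0) ℕ.+_) ih) (first a b _ _)
  where
  first : ∀ a b k l → (a ℕ.+ 0) ℕ.+ (a ℕ.* k ℕ.+ b ℕ.* l) ≡ a ℕ.* suc k ℕ.+ b ℕ.* l
  first = ℕ-Solver.solve-∀
... | false | true  | ih = trans (cong (b ℕ.+_) ih) (second a b _ _)
  where
  second : ∀ a b k l → b ℕ.+ (a ℕ.* k ℕ.+ b ℕ.* l) ≡ a ℕ.* k ℕ.+ b ℕ.* suc l
  second = ℕ-Solver.solve-∀
... | false | false | ih = ih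

-- Pairs with v ≥ w are skipped, so that along allPairs each edge is edited exactly once.
editPairBy : Graph n → (v w : Fin n) → Dec (v Fin.< w) → Graph n → Graph n
editPairBy B v w (yes v<w) C = setEdge C (<⇒≢ v<w) (adj B v w)
editPairBy B v w (no _)    C = C

editPair : Graph n → Fin n × Fin n → Graph n → Graph n
editPair B (v , w) = editPairBy B v w (v Fin.<? w)

editAlong : Graph n → Graph n → List (Fin n × Fin n) → Graph n
editAlong A B = foldr (editPair B) A

editPair-between : (B C : Graph n) (p : Fin n × Fin n) (x y : Fin n)
  → adj (editPair B p C) x y ≡ adj C x y ⊎ adj (editPair B p C) x y ≡ adj B x y
editPair-between B C (v , w) x y = by-cases (v Fin.<? w)
  where
  by-cases : (d : Dec (v Fin.< w))
    → adj (editPairBy B v w d C) x y ≡ adj C x y ⊎ adj (editPairBy B v w d C) x y ≡ adj B x y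
  by-cases (no _)    = inj₁ refl
  by-cases (yes v<w) with sameEnds? v w x y
  ... | yes e = inj₂ (trans (setEdge-sameEnds C (<⇒≢ v<w) (adj B v w) e) (adj-sameEnds B e))
  ... | no ¬e = inj₁ (setEdge-other C (<⇒≢ v<w) (adj B v w) ¬e)

editPair-sets : (B C : Graph n) {x y : Fin n} → x Fin.< y → adj (editPair B (x , y) C) x y ≡ adj B x y
editPair-sets B C {x} {y} x<y = by-cases (x Fin.<? y)
  where
  by-cases : (d : Dec (x Fin.< y)) → adj (editPairBy B x y d C) x y ≡ adj B x y
  by-cases (yes x<y) = setEdge-sameEnds C (<⇒≢ x<y) (adj B x y) (inj₁ (refl , refl))
  by-cases (no x≮y)  = contradiction x<y x≮y

editAlong-between : (A B : Graph n) (L : List (Fin n × Fin n)) (x y : Fin n)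
  → adj (editAlong A B L) x y ≡ adj A x y ⊎ adj (editAlong A B L) x y ≡ adj B x y
editAlong-between A B []      x y = inj₁ refl
editAlong-between A B (p ∷ L) x y with editPair-between B (editAlong A B L) p x y
... | inj₁ unchanged = Sum.map (trans unchanged) (trans unchanged) (editAlong-between A B L x y)
... | inj₂ set       = inj₂ set

editAlong-covers : (A B : Graph n) {L : List (Fin n × Fin n)} {x y : Fin n} → (x , y) ∈ L → x Fin.< y
  → adj (editAlong A B L) x y ≡ adj B x y
editAlong-covers A B {p ∷ L}         (here refl)   x<y = editPair-sets B (editAlong A B L) x<y
editAlong-covers A B {p ∷ L} {x} {y} (there xy∈L) x<y with editPair-between B (editAlong A B L) p x y
... | inj₁ unchanged = trans unchanged (editAlong-covers A B xy∈L x<y)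
... | inj₂ set       = set

editAlong-allPairs : (A B : Graph n) (x y : Fin n) → adj (editAlong A B (allPairs n)) x y ≡ adj B x y
editAlong-allPairs {n} A B x y with <-cmp x y
... | tri< x<y _ _  = editAlong-covers A B (∈-cartesianProduct⁺ (∈-allFin x) (∈-allFin y)) x<y
... | tri≈ _ refl _ = trans (loop (editAlong A B (allPairs n)) x) (≡.sym (loop B x))
... | tri> _ _ y<x  = trans (Graph.sym (editAlong A B (allPairs n)) x y)
  (trans (editAlong-covers A B (∈-cartesianProduct⁺ (∈-allFin y) (∈-allFin x)) y<x) (Graph.sym B y x))

editPair-cost : (A B C : Graph n) {v w : Fin n} → adj C v w ≡ adj A v w ⊎ adj C v w ≡ adj B v w
  → (f : Opinion n) → StrictlyMajoritarian C f
  → ∃[ f′ ] StrictlyMajoritarian (editPair B (v , w) C) f′ × total f′ ≤ total f + + pairCost A B (v , w)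
editPair-cost A B C {v} {w} between f sm = by-cases (v Fin.<? w)
  where
  by-cases : (d : Dec (v Fin.< w))
    → ∃[ f′ ] StrictlyMajoritarian (editPairBy B v w d C) f′ × total f′ ≤ total f + + pairCost A B (v , w)
  by-cases (no _)    = f , sm , ℤₚ.i≤i+j (total f) (+ pairCost A B (v , w))
  by-cases (yes v<w) with setEdge-cost C (<⇒≢ v<w) (adj B v w) f sm
  ... | f′ , sm′ , le = f′ , sm′ , ℤₚ.≤-trans le (ℤₚ.+-monoʳ-≤ (total f) (+≤+ cost≤))
    where
    cost≤ : editCost (adj C v w) (adj B v w) ℕ.≤ pairCost A B (v , w)
    cost≤ = subst (editCost (adj C v w) (adj B v w) ℕ.≤_) (≡.sym (pairCost-< A B v<w)) (editCost-between between)

editAlong-cost : (A B : Graph n) (L : List (Fin n × Fin n)) (f : Opinion n) → StrictlyMajoritarian A f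
  → ∃[ f′ ] StrictlyMajoritarian (editAlong A B L) f′ × total f′ ≤ total f + + sum (map (pairCost A B) L)
editAlong-cost A B []            f sm = f , sm , ℤₚ.i≤i+j (total f) (+ 0)
editAlong-cost A B ((v , w) ∷ L) f sm with editAlong-cost A B L f sm
... | f₁ , sm₁ , le₁ with editPair-cost A B (editAlong A B L) (editAlong-between A B L v w) f₁ sm₁
...   | f₂ , sm₂ , le₂ = f₂ , sm₂ , (begin
  total f₂              ≤⟨ le₂ ⟩
  total f₁ + + c        ≤⟨ ℤₚ.+-monoˡ-≤ (+ c) le₁ ⟩
  total f + + s + + c   ≡⟨ ℤₚ.+-assoc (total f) (+ s) (+ c) ⟩
  total f + (+ s + + c) ≡⟨ cong (λ k → total f + k) (ℤₚ.+-comm (+ s) (+ c)) ⟩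
  total f + (+ c + + s) ≡⟨ cong (λ k → total f + k) (ℤₚ.pos-+ c s) ⟨
  total f + + (c ℕ.+ s) ∎)
  where
  open ℤₚ.≤-Reasoning
  c = pairCost A B (v , w)
  s = sum (map (pairCost A B) L)

γ-bound : (A B : Graph n) {γA γB : ℤ} → IsStrictDomNumber A γA → IsStrictDomNumber B γB
  → γB ≤ γA + (+ 4 * + deletedEdges A B + + 2 * + deletedEdges B A)
γ-bound {n} A B {γB = γB} ((f , sm , refl) , _) (_ , γB-min) with editAlong-cost A B (allPairs n) f sm
... | f′ , sm′ , le = begin
  γB
    ≤⟨ γB-min f′ (majoritarian-cong (editAlong A B (allPairs n)) B (editAlong-allPairs A B) f′ sm′) ⟩
  total f′
    ≤⟨ le ⟩
  total f + + sum (map (pairCost A B) (allPairs n))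
    ≡⟨ cong (λ k → total f + + k) (sum-map-indicators (deleted? A B) (deleted? B A) 4 2 (allPairs n)) ⟩
  total f + + (4 ℕ.* deletedEdges A B ℕ.+ 2 ℕ.* deletedEdges B A)
    ≡⟨ cong (λ k → total f + k) (pos-linear (deletedEdges A B) (deletedEdges B A)) ⟩
  total f + (+ 4 * + deletedEdges A B + + 2 * + deletedEdges B A)
    ∎
  where
  open ℤₚ.≤-Reasoning
  pos-linear : ∀ k l → + (4 ℕ.* k ℕ.+ 2 ℕ.* l) ≡ + 4 * + k + + 2 * + l
  pos-linear k l = trans (ℤₚ.pos-+ (4 ℕ.* k) (2 ℕ.* l)) (cong₂ _+_ (ℤₚ.pos-* 4 k) (ℤₚ.pos-* 2 l))

i≤j+[a+b]⇒i-j≤b+a : ∀ i j a b → i ≤ j + (a + b) → i - j ≤ b + a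
i≤j+[a+b]⇒i-j≤b+a i j a b i≤ =
  ℤₚ.≤-trans (ℤₚ.+-monoˡ-≤ (- j) i≤) (ℤₚ.≤-reflexive (cancel j a b))
  where
  cancel : ∀ j a b → j + (a + b) - j ≡ b + a
  cancel = solve-∀

j≤i+[a+b]⇒-a-b≤i-j : ∀ i j a b → j ≤ i + (a + b) → - a - b ≤ i - j
j≤i+[a+b]⇒-a-b≤i-j i j a b j≤ =
  ℤₚ.≤-trans (ℤₚ.≤-reflexive (cancel i a b)) (ℤₚ.+-monoʳ-≤ i (ℤₚ.neg-mono-≤ j≤))
  where
  cancel : ∀ i a b → - a - b ≡ i + - (i + (a + b))
  cancel = solve-∀

theorem3 : (n : ℕ) (G H : Graph (suc n)) (l m : ℕ)
    → deletedEdges G H ≡ l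
    → deletedEdges H G ≡ m
    → (γG γH : ℤ) → IsStrictDomNumber G γG → IsStrictDomNumber H γH
    → (- (+ 4 * + l) - + 2 * + m ≤ γG - γH) × (γG - γH ≤ + 2 * + l + + 4 * + m)
theorem3 n G H l m refl refl γG γH γ[G] γ[H] =
    j≤i+[a+b]⇒-a-b≤i-j γG γH (+ 4 * + l) (+ 2 * + m) (γ-bound G H γ[G] γ[H])
  , i≤j+[a+b]⇒i-j≤b+a γG γH (+ 4 * + m) (+ 2 * + l) (γ-bound H G γ[H] γ[G])
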